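{- Let $G$ be a finite simple graph having a pair of distinct twins $u,v$ (i.e. $N(u)=N(v)$ or $N[u]=N[v]$). Then for every integer $k\ge 2$, $\mathrm{Z}_t^k(G)$ does not exist.
   Context: $N(x)$ and $N[x]$ are the open and closed neighborhoods of $x$. Zero forcing: given a set $B\subseteq V(G)$ of initially blue vertices (all others white), the color change rule allows a blue vertex $b$ to turn a white vertex $w$ blue if $w$ is the unique white neighbor of $b$. $B$ is a zero forcing set if repeated application of this rule eventually turns all of $V(G)$ blue. For an integer $k\ge 1$, a set $B\subseteq V(G)$ with $|B|=m\ge k$ is a $k$-fault tolerant zero forcing set if every subset $F\subseteq B$ with $|F|=m-k$ is a zero forcing set of $G$. $\mathrm{Z}_t^k(G)$ is the minimum cardinality of a $k$-fault tolerant zero forcing set of $G$, and is said not to exist if no such set exists. -}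

module Defs where

open import Data.Nat using (ℕ; _≥_; _∸_)
open import Data.Bool using (Bool; true; false)
open import Data.Fin using (Fin)
open import Data.Fin.Subset using (Subset; _∈_; _∉_; _⊆_; ∣_∣; ⊤; _∪_; ⁅_⁆)
open import Data.Product using (Σ; _×_; ∃)
open import Data.Sum using (_⊎_)
open import Relation.Binary.PropositionalEquality using (_≡_; _≢_)
open import Relation.Binary.Construct.Closure.ReflexiveTransitive using (Star)
open import Relation.Nullary using (¬_)

record Graph (n : ℕ) : Set where
  field
    Adj   : Fin n → Fin n → Bool
    sym   : ∀ x y → Adj x y ≡ Adj y x
    irref : ∀ x → Adj x x ≡ false

open Graph public

module _ {n : ℕ} (G : Graph n) where

  _~_ : Fin n → Fin n → Set
  x ~ y = Adj G x y ≡ true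

  OpenTwins : Fin n → Fin n → Set
  OpenTwins u v = ∀ w → (u ~ w → v ~ w) × (v ~ w → u ~ w)

  ClosedTwins : Fin n → Fin n → Set
  ClosedTwins u v = ∀ w → ((w ≡ u ⊎ u ~ w) → (w ≡ v ⊎ v ~ w))
                        × ((w ≡ v ⊎ v ~ w) → (w ≡ u ⊎ u ~ w))

  data ForceStep (S : Subset n) : Subset n → Set where
    force : (b w : Fin n) → b ∈ S → w ∉ S → b ~ w →
            (∀ x → b ~ x → x ≢ w → x ∈ S) →
            ForceStep S (S ∪ ⁅ w ⁆)

  ZeroForcingSet : Subset n → Set
  ZeroForcingSet B = Star ForceStep B ⊤

  FaultTolerantZFS : ℕ → Subset n → Set
  FaultTolerantZFS k B =
    ∣ B ∣ ≥ k × (∀ F → F ⊆ B → ∣ F ∣ ≡ ∣ B ∣ ∸ k → ZeroForcingSet F)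

  ZtkExists : ℕ → Set
  ZtkExists k = ∃ λ B → FaultTolerantZFS k B

{-# OPTIONS --safe #-}
-- If distinct twins u and v are both white, neither can ever be
-- forced, since any blue neighbour of one is a blue neighbour (or, for closed
-- twins, the other twin itself) of the other and so sees two white vertices.
-- Hence no set avoiding u and v is zero forcing; but for k ≥ 2 every set B has
-- a subset of size ∣ B ∣ ∸ k avoiding u and v.
module Submission where

open import Defs hiding (sym)
open import Data.Nat using (ℕ; zero; suc; _≤_; _≥_; _∸_; s≤s)
open import Data.Nat.Properties using (≤-refl; ≤-trans; n≤1+n; ∸-monoʳ-≤; m≤n+o⇒m∸n≤o)
open import Data.Fin using (Fin; zero; suc)
open import Data.Fin.Subset
  using (Subset; inside; outside; _∈_; _∉_; _⊆_; ∣_∣; ⊥; _∪_; ⁅_⁆; _-_)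
open import Data.Fin.Subset.Properties
  using (∈⊤; ∉⊥; ∣⊥∣≡0; x∈⁅y⁆⇒x≡y; x∈p∪q⁻; p─⊥≡p; p─q⊆p; ⊆-trans)
open import Data.Vec using (_∷_; here; there)
open import Data.Product using (∃; _×_; _,_; proj₁; proj₂)
open import Data.Sum using (_⊎_; inj₁; inj₂)
open import Function using (_∘_)
open import Relation.Binary.PropositionalEquality using (_≡_; _≢_; refl; sym; trans; cong; subst)
open import Relation.Binary.Construct.Closure.ReflexiveTransitive using (ε; _◅_)
open import Relation.Nullary using (¬_; contradiction)

∣x∷p∣≤1+∣p∣ : ∀ {n} x (p : Subset n) → ∣ x ∷ p ∣ ≤ suc ∣ p ∣
∣x∷p∣≤1+∣p∣ inside  p = ≤-refl
∣x∷p∣≤1+∣p∣ outside p = n≤1+n ∣ p ∣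

x∉p-x : ∀ {n} (p : Subset n) x → x ∉ p - x
x∉p-x (_ ∷ p) (suc x) (there x∈p-x) = x∉p-x p x x∈p-x

∣p∣≤1+∣p-x∣ : ∀ {n} (p : Subset n) x → ∣ p ∣ ≤ suc ∣ p - x ∣
∣p∣≤1+∣p-x∣ (b ∷ p) zero    = subst (λ q → ∣ b ∷ p ∣ ≤ suc ∣ q ∣) (sym (p─⊥≡p p)) (∣x∷p∣≤1+∣p∣ b p)
∣p∣≤1+∣p-x∣ (inside  ∷ p) (suc x) = s≤s (∣p∣≤1+∣p-x∣ p x)
∣p∣≤1+∣p-x∣ (outside ∷ p) (suc x) = ∣p∣≤1+∣p-x∣ p x

⊆-of-size : ∀ {n} (p : Subset n) {m} → m ≤ ∣ p ∣ → ∃ λ q → q ⊆ p × ∣ q ∣ ≡ m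
⊆-of-size {n} p {zero} _ = ⊥ , (λ x∈⊥ → contradiction x∈⊥ ∉⊥) , ∣⊥∣≡0 n
⊆-of-size (outside ∷ p) m≤∣p∣ with ⊆-of-size p m≤∣p∣
... | q , q⊆p , ∣q∣≡m = outside ∷ q , (λ { (there x∈q) → there (q⊆p x∈q) }) , ∣q∣≡m
⊆-of-size (inside ∷ p) {suc m} (s≤s m≤∣p∣) with ⊆-of-size p m≤∣p∣
... | q , q⊆p , ∣q∣≡m = inside ∷ q , (λ { here → here ; (there x∈q) → there (q⊆p x∈q) }) , cong suc ∣q∣≡m

⊆-of-size-avoiding : ∀ {n} (p : Subset n) x y {k} → k ≥ 2 →
                     ∃ λ q → q ⊆ p × ∣ q ∣ ≡ ∣ p ∣ ∸ k × x ∉ q × y ∉ q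
⊆-of-size-avoiding p x y {k} k≥2 with ⊆-of-size (p - x - y) size-fits
  where
  size-fits : ∣ p ∣ ∸ k ≤ ∣ p - x - y ∣
  size-fits = ≤-trans (∸-monoʳ-≤ ∣ p ∣ k≥2)
    (m≤n+o⇒m∸n≤o ∣ p ∣ 2 (≤-trans (∣p∣≤1+∣p-x∣ p x) (s≤s (∣p∣≤1+∣p-x∣ (p - x) y))))
... | q , q⊆p-x-y , ∣q∣≡∣p∣∸k =
  q , ⊆-trans q⊆p-x-y (⊆-trans p-x-y⊆p-x (p─q⊆p p ⁅ x ⁆)) , ∣q∣≡∣p∣∸k ,
  x∉p-x p x ∘ p-x-y⊆p-x ∘ q⊆p-x-y , x∉p-x (p - x) y ∘ q⊆p-x-y
  where
  p-x-y⊆p-x : p - x - y ⊆ p - x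
  p-x-y⊆p-x = p─q⊆p (p - x) ⁅ y ⁆

module _ {n : ℕ} (G : Graph n) where

  Twins : Fin n → Fin n → Set
  Twins u v = OpenTwins G u v ⊎ ClosedTwins G u v

  Twins-sym : ∀ {u v} → Twins u v → Twins v u
  Twins-sym (inj₁ t) = inj₁ (λ w → proj₂ (t w) , proj₁ (t w))
  Twins-sym (inj₂ t) = inj₂ (λ w → proj₂ (t w) , proj₁ (t w))

  ~-sym : ∀ {x y} → _~_ G x y → _~_ G y x
  ~-sym {x} {y} x~y = trans (Graph.sym G y x) x~y

  forced-vertex-twin-blue : ∀ {S b w v} → w ≢ v → Twins w v → b ∈ S → _~_ G b w →
                            (∀ x → _~_ G b x → x ≢ w → x ∈ S) → v ∈ S
  forced-vertex-twin-blue w≢v (inj₁ t) b∈S b~w others-blue =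
    others-blue _ (~-sym (proj₁ (t _) (~-sym b~w))) (w≢v ∘ sym)
  forced-vertex-twin-blue w≢v (inj₂ t) b∈S b~w others-blue with proj₁ (t _) (inj₂ (~-sym b~w))
  ... | inj₁ refl = b∈S
  ... | inj₂ v~b  = others-blue _ (~-sym v~b) (w≢v ∘ sym)

  white-twins-stay-white : ∀ {u v S T} → u ≢ v → Twins u v → u ∉ S → v ∉ S →
                           ForceStep G S T → u ∉ T × v ∉ T
  white-twins-stay-white {u} {v} {S} u≢v twins u∉S v∉S (force b w b∈S _ b~w others-blue) =
    stays-white u∉S u≢w , stays-white v∉S v≢w
    where
    u≢w : u ≢ w
    u≢w refl = v∉S (forced-vertex-twin-blue u≢v twins b∈S b~w others-blue)
    v≢w : v ≢ w
    v≢w refl = u∉S (forced-vertex-twin-blue (u≢v ∘ sym) (Twins-sym twins) b∈S b~w others-blue)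
    stays-white : ∀ {x} → x ∉ S → x ≢ w → x ∉ S ∪ ⁅ w ⁆
    stays-white x∉S x≢w x∈S∪w with x∈p∪q⁻ S ⁅ w ⁆ x∈S∪w
    ... | inj₁ x∈S = x∉S x∈S
    ... | inj₂ x∈w = x≢w (x∈⁅y⁆⇒x≡y w x∈w)

  white-twins-not-zero-forcing : ∀ {u v S} → u ≢ v → Twins u v → u ∉ S → v ∉ S →
                                 ¬ ZeroForcingSet G S
  white-twins-not-zero-forcing u≢v twins u∉S v∉S ε = u∉S ∈⊤
  white-twins-not-zero-forcing u≢v twins u∉S v∉S (step ◅ steps)
    with white-twins-stay-white u≢v twins u∉S v∉S step
  ... | u∉T , v∉T = white-twins-not-zero-forcing u≢v twins u∉T v∉T steps

corollary4p12 : {n : ℕ} (G : Graph n) (u v : Fin n) → u ≢ v →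
    (OpenTwins G u v ⊎ ClosedTwins G u v) →
    (k : ℕ) → k ≥ 2 → ¬ ZtkExists G k
corollary4p12 G u v u≢v twins k k≥2 (B , _ , faults-tolerated) =
  let F , F⊆B , ∣F∣≡∣B∣∸k , u∉F , v∉F = ⊆-of-size-avoiding B u v k≥2
  in white-twins-not-zero-forcing G u≢v twins u∉F v∉F (faults-tolerated F F⊆B ∣F∣≡∣B∣∸k)
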